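{- $\kappa^s(Q_7;K_{1,6})\ge 4$.
   Context: The $n$-dimensional hypercube $Q_n$ has as vertices all binary strings of length $n$, two strings being adjacent iff they differ in exactly one position. $K_{1,r}$ denotes the star with $r$ leaves. For a graph $G$ and a set $F$ of subgraphs of $G$, $G-F$ denotes the graph obtained from $G$ by deleting all vertices of all members of $F$. For a connected graph $T$, $\kappa^s(G;T)$ is the minimum cardinality of a set $F$ of subgraphs of $G$, each isomorphic to a connected subgraph of $T$, such that $G-F$ is disconnected. -}

module Defs where

open import Data.Nat using (ℕ; zero; suc; _+_; _≤_)
open import Data.Bool using (Bool; true; false; _xor_)
open import Data.Vec using (Vec; []; _∷_)
open import Data.List using (List; length)
open import Data.List.Membership.Propositional using (_∈_)
open import Data.List.Relation.Unary.All using (All)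
open import Data.List.Relation.Unary.Any using (Any)
open import Data.List.Relation.Unary.Unique.Propositional using (Unique)
open import Data.Product using (Σ; _×_; ∃)
open import Data.Sum using (_⊎_)
open import Relation.Binary.PropositionalEquality using (_≡_)
open import Relation.Nullary using (¬_)

Vertex : ℕ → Set
Vertex n = Vec Bool n

hamming : ∀ {n} → Vertex n → Vertex n → ℕ
hamming [] [] = 0
hamming (a ∷ u) (b ∷ v) with a xor b
... | true  = suc (hamming u v)
... | false = hamming u v

Adj : ∀ {n} → Vertex n → Vertex n → Set
Adj u v = hamming u v ≡ 1

-- A subgraph of Q_n isomorphic to a connected subgraph of K_{1,6}.
-- The connected subgraphs of K_{1,6} are exactly K_{1,r}, 0 ≤ r ≤ 6
-- (K_{1,0} = K_1, K_{1,1} = K_2).  Such a subgraph of Q_n is given by a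
-- centre c and r ≤ 6 distinct neighbours of c.  Only its vertex set
-- matters for vertex deletion.
record StarSub (n : ℕ) : Set where
  field
    center   : Vertex n
    leaves   : List (Vertex n)
    distinct : Unique leaves
    few      : length leaves ≤ 6
    adjacent : All (Adj center) leaves
open StarSub public

Removed : ∀ {n} → List (StarSub n) → Vertex n → Set
Removed F v = Any (λ S → v ≡ center S ⊎ v ∈ leaves S) F

-- Reachability inside Q_n - F (u itself assumed to be a vertex of Q_n - F).
data Reach {n : ℕ} (F : List (StarSub n)) : Vertex n → Vertex n → Set where
  here : ∀ {u} → Reach F u u
  step : ∀ {u w v} → Adj u w → ¬ Removed F w → Reach F w v → Reach F u v

Disconnected : ∀ {n} → List (StarSub n) → Set
Disconnected {n} F =
  Σ (Vertex n) λ u → Σ (Vertex n) λ v →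
    ¬ Removed F u × ¬ Removed F v × ¬ Reach F u v

module Submission where

-- Weight a star 2, a single vertex 1 and the empty set 0; by induction on n, deleting pieces
-- of total weight < n from Q_n leaves it connected.  If all weighted pieces share a centre c,
-- the deleted set lies in the closed neighbourhood of c, and every surviving vertex walks away
-- from c to the antipode of c.  Otherwise some coordinate i separates two centres.  Cutting
-- Q_n along i, a piece centred on the other side loses one unit of weight in a half (a star
-- becomes a vertex, a vertex disappears), and each half sees such a piece, so both halves
-- are connected.  As the total weight is at most n - 1, some vertex w of Q_(n-1) is, for every
-- piece, at distance at least its weight from the projected centre; both lifts of w survive
-- and join the halves.  Three stars weigh 6 < 7, whatever their number of leaves.

open import Defs
open import Data.Nat using (ℕ; zero; suc; _+_; _*_; _∸_; _≤_; _<_; z≤n; s≤s; z<s; s≤s⁻¹)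
open import Data.Nat.Properties
  using ( ≤-refl; ≤-trans; <-trans; <-≤-trans; ≤-<-trans; n<1+n; <⇒≱; ≰⇒>; _≤?_; _<?_
        ; n≤0⇒n≡0; m≤n+m; m∸n≤m; m+n≤o⇒m≤o∸n; ∸-monoʳ-<; +-comm; +-mono-≤
        ; +-monoʳ-<; +-mono-<-≤; +-mono-≤-<; *-monoˡ-≤; +-commutativeSemigroup)
open import Algebra.Properties.CommutativeSemigroup +-commutativeSemigroup using (x∙yz≈y∙xz)
open import Data.Nat.ListAction using (sum)
open import Data.Bool using (Bool; true; false; not; if_then_else_; _xor_)
open import Data.Bool.Properties using (_≟_; ¬-not)
open import Data.Fin using (Fin; zero; suc)
open import Data.Vec using ([]; _∷_; lookup; replicate; insertAt; removeAt; tail)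
import Data.Vec as Vec
open import Data.Vec.Properties using (insertAt-removeAt; ≡-dec)
open import Data.List using (List; []; _∷_; length; map)
open import Data.List.Properties using (map-∘)
open import Data.List.Relation.Unary.All using (All; []; _∷_)
import Data.List.Relation.Unary.All as All
open import Data.List.Relation.Unary.All.Properties using (All¬⇒¬Any)
import Data.List.Relation.Unary.All.Properties as Allₚ
open import Data.List.Relation.Unary.Any using (Any; here; there)
import Data.List.Relation.Unary.Any.Properties as Any
open import Data.List.Membership.Propositional using (_∈_; find; lose)
open import Data.Product using (∃; _×_; _,_; proj₁; proj₂; map₂)
open import Data.Sum using (_⊎_; inj₁; inj₂)
open import Function using (_∘_; id)
open import Level using (Level; 0ℓ)
import Level
open import Relation.Binary.Construct.Closure.ReflexiveTransitive using (Star; ε; _◅_; _◅◅_; gmap; reverse)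
open import Relation.Binary.PropositionalEquality
  using (_≡_; _≢_; refl; sym; trans; cong; cong₂; subst; subst₂; module ≡-Reasoning)
open import Relation.Nullary using (¬_; Dec; yes; no; contradiction)
open import Relation.Unary using (Pred; _≐_)

private
  variable
    n : ℕ
    ℓ ℓ′ : Level

bitDistance : Bool → Bool → ℕ
bitDistance a b = if a xor b then 1 else 0

bitDistance-refl : ∀ a → bitDistance a a ≡ 0
bitDistance-refl true  = refl
bitDistance-refl false = refl

bitDistance-≢ : ∀ {a b} → a ≢ b → bitDistance a b ≡ 1
bitDistance-≢ {true}  {true}  a≢b = contradiction refl a≢b
bitDistance-≢ {true}  {false} _   = refl
bitDistance-≢ {false} {true}  _   = refl
bitDistance-≢ {false} {false} a≢b = contradiction refl a≢b

bitDistance≡0⇒≡ : ∀ {a b} → bitDistance a b ≡ 0 → a ≡ b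
bitDistance≡0⇒≡ {true}  {true}  _ = refl
bitDistance≡0⇒≡ {false} {false} _ = refl

hamming-∷ : ∀ a b (u v : Vertex n) → hamming (a ∷ u) (b ∷ v) ≡ bitDistance a b + hamming u v
hamming-∷ true  true  u v = refl
hamming-∷ true  false u v = refl
hamming-∷ false true  u v = refl
hamming-∷ false false u v = refl

hamming-∷-not : ∀ a (u v : Vertex n) → hamming (a ∷ u) (not a ∷ v) ≡ suc (hamming u v)
hamming-∷-not true  u v = refl
hamming-∷-not false u v = refl

hamming-self : (u : Vertex n) → hamming u u ≡ 0
hamming-self []          = refl
hamming-self (true ∷ u)  = hamming-self u
hamming-self (false ∷ u) = hamming-self u

hamming-sym : (u v : Vertex n) → hamming u v ≡ hamming v u
hamming-sym []          []          = refl
hamming-sym (true ∷ u)  (true ∷ v)  = hamming-sym u v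
hamming-sym (true ∷ u)  (false ∷ v) = cong suc (hamming-sym u v)
hamming-sym (false ∷ u) (true ∷ v)  = cong suc (hamming-sym u v)
hamming-sym (false ∷ u) (false ∷ v) = hamming-sym u v

hamming≡0⇒≡ : (u v : Vertex n) → hamming u v ≡ 0 → u ≡ v
hamming≡0⇒≡ []          []          _ = refl
hamming≡0⇒≡ (true ∷ u)  (true ∷ v)  h = cong (true ∷_) (hamming≡0⇒≡ u v h)
hamming≡0⇒≡ (false ∷ u) (false ∷ v) h = cong (false ∷_) (hamming≡0⇒≡ u v h)

hamming-insertAt : ∀ (i : Fin (suc n)) a b (u v : Vertex n) →
                   hamming (insertAt u i a) (insertAt v i b) ≡ bitDistance a b + hamming u v
hamming-insertAt zero    a b u       v       = hamming-∷ a b u v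
hamming-insertAt (suc i) a b (x ∷ u) (y ∷ v) = begin
  hamming (x ∷ insertAt u i a) (y ∷ insertAt v i b)       ≡⟨ hamming-∷ x y _ _ ⟩
  bitDistance x y + hamming (insertAt u i a) (insertAt v i b)
                                                           ≡⟨ cong (bitDistance x y +_) (hamming-insertAt i a b u v) ⟩
  bitDistance x y + (bitDistance a b + hamming u v)       ≡⟨ x∙yz≈y∙xz (bitDistance x y) (bitDistance a b) (hamming u v) ⟩
  bitDistance a b + (bitDistance x y + hamming u v)       ≡⟨ cong (bitDistance a b +_) (hamming-∷ x y u v) ⟨
  bitDistance a b + hamming (x ∷ u) (y ∷ v)               ∎
  where open ≡-Reasoning

hamming-split : ∀ (i : Fin (suc n)) (u : Vertex (suc n)) b (w : Vertex n) →
                hamming u (insertAt w i b) ≡ bitDistance (lookup u i) b + hamming (removeAt u i) w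
hamming-split i u b w =
  trans (cong (λ z → hamming z (insertAt w i b)) (sym (insertAt-removeAt u i)))
        (hamming-insertAt i (lookup u i) b (removeAt u i) w)

Adj-sym : {u v : Vertex n} → Adj u v → Adj v u
Adj-sym {u = u} {v} adj = trans (hamming-sym v u) adj

Adj-insertAt : ∀ (i : Fin (suc n)) b {x y : Vertex n} → Adj x y → Adj (insertAt x i b) (insertAt y i b)
Adj-insertAt i b {x} {y} adj =
  trans (hamming-insertAt i b b x y) (trans (cong (_+ hamming x y) (bitDistance-refl b)) adj)

Adj-insertAt-≢ : ∀ (i : Fin (suc n)) {a b} (w : Vertex n) → a ≢ b → Adj (insertAt w i a) (insertAt w i b)
Adj-insertAt-≢ i w a≢b = trans (hamming-insertAt i _ _ w w) (cong₂ _+_ (bitDistance-≢ a≢b) (hamming-self w))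

≢⇒lookup≢ : {u v : Vertex n} → u ≢ v → ∃ λ i → lookup u i ≢ lookup v i
≢⇒lookup≢ {u = []}    {[]}    u≢v = contradiction refl u≢v
≢⇒lookup≢ {u = x ∷ u} {y ∷ v} u≢v with x ≟ y
... | no x≢y   = zero , x≢y
... | yes refl with ≢⇒lookup≢ (u≢v ∘ cong (x ∷_))
...   | i , differ = suc i , differ

Edge : Pred (Vertex n) ℓ → Vertex n → Vertex n → Set ℓ
Edge B u v = Adj u v × ¬ B u × ¬ B v

Connected : Pred (Vertex n) ℓ → Set ℓ
Connected B = ∀ {u v} → ¬ B u → ¬ B v → Star (Edge B) u v

module _ {B : Pred (Vertex n) ℓ} where

  Edge-sym : ∀ {u v} → Edge B u v → Edge B v u
  Edge-sym {u} {v} (adj , ¬Bu , ¬Bv) = Adj-sym {u = u} {v} adj , ¬Bv , ¬Bu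

  Connected-resp-≐ : {B′ : Pred (Vertex n) ℓ′} → B ≐ B′ → Connected B → Connected B′
  Connected-resp-≐ (B⊆B′ , B′⊆B) connected ¬B′u ¬B′v =
    gmap id (λ (adj , ¬Bu , ¬Bv) → adj , ¬Bu ∘ B′⊆B , ¬Bv ∘ B′⊆B)
         (connected (¬B′u ∘ B⊆B′) (¬B′v ∘ B⊆B′))

module _ {B : Pred (Vertex (suc n)) ℓ} (i : Fin (suc n)) (b : Bool) where

  lift-path : ∀ {x y} → Star (Edge (λ z → B (insertAt z i b))) x y →
              Star (Edge B) (insertAt x i b) (insertAt y i b)
  lift-path = gmap (λ z → insertAt z i b) (λ (adj , ¬Bx , ¬By) → Adj-insertAt i b adj , ¬Bx , ¬By)

antipode : Vertex n → Vertex n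
antipode = Vec.map not

FreeBeyond : Pred (Vertex n) ℓ → Vertex n → Vertex n → Set ℓ
FreeBeyond B c u = ∀ {w} → hamming c u < hamming c w → ¬ B w

hamming-away : ∀ a (c u : Vertex n) → hamming (a ∷ c) (a ∷ u) < hamming (a ∷ c) (not a ∷ u)
hamming-away true  c u = n<1+n (hamming c u)
hamming-away false c u = n<1+n (hamming c u)

-- Flip, one at a time, the coordinates in which u still agrees with c.
climb : {B : Pred (Vertex n) ℓ} (c u : Vertex n) → ¬ B u → FreeBeyond B c u →
        Star (Edge B) u (antipode c)
climb []       []      _   _    = ε
climb {B = B} (c₀ ∷ c) (a ∷ u) ¬Bu free = by-head (a ≟ c₀)
  where
  climb-tail : ∀ x → ¬ B (x ∷ u) → FreeBeyond B (c₀ ∷ c) (x ∷ u) →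
               Star (Edge B) (x ∷ u) (x ∷ antipode c)
  climb-tail x ¬Bxu free′ = lift-path zero x (climb c u ¬Bxu (free′ ∘ tail-farther))
    where
    tail-farther : ∀ {w} → hamming c u < hamming c w → hamming (c₀ ∷ c) (x ∷ u) < hamming (c₀ ∷ c) (x ∷ w)
    tail-farther {w} lt = subst₂ _<_ (sym (hamming-∷ c₀ x c u)) (sym (hamming-∷ c₀ x c w)) (+-monoʳ-< _ lt)

  by-head : Dec (a ≡ c₀) → Star (Edge B) (a ∷ u) (antipode (c₀ ∷ c))
  by-head (no a≢c₀) =
    subst (λ x → Star (Edge B) (a ∷ u) (x ∷ antipode c)) (¬-not a≢c₀) (climb-tail a ¬Bu free)
  by-head (yes refl) =
    (flip , ¬Bu , free away) ◅ climb-tail (not c₀) (free away) (free ∘ <-trans away)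
    where
    away = hamming-away c₀ c u
    flip : Adj (c₀ ∷ u) (not c₀ ∷ u)
    flip = trans (hamming-∷-not c₀ u u) (cong suc (hamming-self u))

WithinStar : Vertex n → Pred (Vertex n) ℓ → Set ℓ
WithinStar c B = ∀ {x} → B x → hamming c x < 2 × (Adj c x → B c)

below-2 : ∀ {k l} → k < l → l < 2 → k ≡ 0 × l ≡ 1
below-2 {zero}  {suc zero}    _        _                 = refl , refl
below-2 {zero}  {suc (suc _)} _        (s≤s (s≤s ()))
below-2 {suc _} {suc zero}    (s≤s ()) _
below-2 {suc _} {suc (suc _)} _        (s≤s (s≤s ()))

within-star-connected : {B : Pred (Vertex n) ℓ} (c : Vertex n) → WithinStar c B → Connected B
within-star-connected {B = B} c within ¬Bu ¬Bv =
  climb c _ ¬Bu (free ¬Bu) ◅◅ reverse (Edge-sym {B = B}) (climb c _ ¬Bv (free ¬Bv))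
  where
  free : ∀ {u} → ¬ B u → FreeBeyond B c u
  free {u} ¬Bu lt Bw with within Bw
  ... | near , centre-blocked with below-2 lt near
  ...   | hu≡0 , hw≡1 = ¬Bu (subst B (hamming≡0⇒≡ c u hu≡0) (centre-blocked hw≡1))

connected-from-slices : {B : Pred (Vertex (suc n)) ℓ} (i : Fin (suc n)) (w : Vertex n) →
                        (∀ b → Connected (λ x → B (insertAt x i b))) →
                        (∀ b → ¬ B (insertAt w i b)) → Connected B
connected-from-slices {B = B} i w slice-connected bridge {u} {v} ¬Bu ¬Bv =
  subst₂ (Star (Edge B)) (insertAt-removeAt u i) (insertAt-removeAt v i)
    (lift-path i a (slice-connected a (¬Bu ∘ subst B (insertAt-removeAt u i)) (bridge a))
     ◅◅ cross a b
     ◅◅ lift-path i b (slice-connected b (bridge b) (¬Bv ∘ subst B (insertAt-removeAt v i))))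
  where
  a = lookup u i
  b = lookup v i
  cross : ∀ s t → Star (Edge B) (insertAt w i s) (insertAt w i t)
  cross s t with s ≟ t
  ... | yes refl = ε
  ... | no s≢t   = (Adj-insertAt-≢ i w s≢t , bridge s , bridge t) ◅ ε

Far : Vertex n → ℕ × Vertex n → Set
Far w (k , d) = k ≤ hamming d w

-- Greedily spend each coordinate on moving away from a point that is still too close.
far-vertex : (l : List (ℕ × Vertex n)) → sum (map proj₁ l) ≤ n → ∃ λ w → All (Far w) l
far-vertex []               _     = replicate _ false , []
far-vertex ((zero , d) ∷ l) small = map₂ (z≤n ∷_) (far-vertex l small)
far-vertex {zero}  ((suc k , d)     ∷ l) ()
far-vertex {suc n} ((suc k , x ∷ d) ∷ l) (s≤s small)
  with far-vertex ((k , d) ∷ map (map₂ tail) l) (subst (λ s → k + s ≤ n) (cong sum (map-∘ l)) small)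
... | w , far-d ∷ far-l = not x ∷ w , far-x∷d ∷ All.map (λ {e} → far-∷ e) (Allₚ.map⁻ far-l)
  where
  far-x∷d : suc k ≤ hamming (x ∷ d) (not x ∷ w)
  far-x∷d = subst (suc k ≤_) (sym (hamming-∷-not x d w)) (s≤s far-d)
  far-∷ : ∀ e → Far w (map₂ tail e) → Far (not x ∷ w) e
  far-∷ (k′ , y ∷ d′) far = ≤-trans far (subst (hamming d′ w ≤_) (sym (hamming-∷ y (not x) d′ w)) (m≤n+m _ _))

-- Weight 0: empty; weight 1: at most the centre; weight 2: part of the closed star at the centre.
record Piece (n : ℕ) : Set₁ where
  field
    centre        : Vertex n
    weight        : ℕ
    Member        : Pred (Vertex n) 0ℓ
    weight≤2      : weight ≤ 2
    near-centre   : ∀ {x} → Member x → hamming centre x < weight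
    centre-member : ∀ {x} → Member x → Adj centre x → Member centre
open Piece

Blocked : List (Piece n) → Pred (Vertex n) (Level.suc 0ℓ)
Blocked ps x = Any (λ p → Member p x) ps

cost : List (Piece n) → ℕ
cost ps = sum (map weight ps)

module _ (i : Fin (suc n)) (b : Bool) where

  slice : Piece (suc n) → Piece n
  slice p = record
    { centre        = d
    ; weight        = weight p ∸ bitDistance a b
    ; Member        = λ w → Member p (insertAt w i b)
    ; weight≤2      = ≤-trans (m∸n≤m (weight p) (bitDistance a b)) (weight≤2 p)
    ; near-centre   = near
    ; centre-member = centred
    }
    where
    a = lookup (centre p) i
    d = removeAt (centre p) i

    distance : ∀ w → hamming (centre p) (insertAt w i b) ≡ bitDistance a b + hamming d w
    distance = hamming-split i (centre p) b

    near : ∀ {w} → Member p (insertAt w i b) → hamming d w < weight p ∸ bitDistance a b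
    near {w} m = m+n≤o⇒m≤o∸n (suc (hamming d w))
      (subst (_≤ weight p) (cong suc (trans (distance w) (+-comm (bitDistance a b) _))) (near-centre p m))

    -- Members lie within distance 1 of the centre, which therefore lies in this slice.
    centred : ∀ {w} → Member p (insertAt w i b) → Adj d w → Member p (insertAt d i b)
    centred {w} m adj = subst (Member p) centre≡ (centre-member p m adj′)
      where
      close : bitDistance a b + 1 < weight p
      close = subst (_< weight p) (trans (distance w) (cong (bitDistance a b +_) adj)) (near-centre p m)
      δ≡0 : bitDistance a b ≡ 0
      δ≡0 = n≤0⇒n≡0 (m+n≤o⇒m≤o∸n (bitDistance a b) (s≤s⁻¹ (≤-trans close (weight≤2 p))))
      adj′ : Adj (centre p) (insertAt w i b)
      adj′ = trans (distance w) (cong₂ _+_ δ≡0 adj)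
      centre≡ : centre p ≡ insertAt d i b
      centre≡ = trans (sym (insertAt-removeAt (centre p) i)) (cong (insertAt d i) (bitDistance≡0⇒≡ δ≡0))

  slice-weight-≤ : (p : Piece (suc n)) → weight (slice p) ≤ weight p
  slice-weight-≤ p = m∸n≤m (weight p) (bitDistance (lookup (centre p) i) b)

  Blocked-slice : (ps : List (Piece (suc n))) → Blocked (map slice ps) ≐ (λ w → Blocked ps (insertAt w i b))
  Blocked-slice ps = Any.map⁻ , Any.map⁺

  cost-slice-≤ : (ps : List (Piece (suc n))) → cost (map slice ps) ≤ cost ps
  cost-slice-≤ []       = z≤n
  cost-slice-≤ (p ∷ ps) = +-mono-≤ (slice-weight-≤ p) (cost-slice-≤ ps)

  cost-slice-< : (ps : List (Piece (suc n))) → Any (λ p → 0 < weight p × lookup (centre p) i ≢ b) ps →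
                 cost (map slice ps) < cost ps
  cost-slice-< (p ∷ ps) (here (positive , a≢b)) =
    +-mono-<-≤ (subst (λ δ → weight p ∸ δ < weight p) (sym (bitDistance-≢ a≢b)) (∸-monoʳ-< z<s positive))
               (cost-slice-≤ ps)
  cost-slice-< (p ∷ ps) (there stray) = +-mono-≤-< (slice-weight-≤ p) (cost-slice-< ps stray)

  bridge : (ps : List (Piece (suc n))) (w : Vertex n) →
           All (λ p → weight p ≤ hamming (removeAt (centre p) i) w) ps → ¬ Blocked ps (insertAt w i b)
  bridge ps w far = All¬⇒¬Any (All.map (λ {p} → unblocked p) far)
    where
    unblocked : ∀ p → weight p ≤ hamming (removeAt (centre p) i) w → ¬ Member p (insertAt w i b)
    unblocked p far-p m = <⇒≱ (near-centre p m) (subst (weight p ≤_) (sym (hamming-split i (centre p) b w)) far-p′)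
      where
      far-p′ : weight p ≤ bitDistance (lookup (centre p) i) b + hamming (removeAt (centre p) i) w
      far-p′ = ≤-trans far-p (m≤n+m _ _)

Concentric : Vertex n → List (Piece n) → Set₁
Concentric c = All (λ p → 0 < weight p → centre p ≡ c)

Straddles : Fin n → List (Piece n) → Set₁
Straddles i ps = ∀ b → Any (λ p → 0 < weight p × lookup (centre p) i ≢ b) ps

Member⇒weight>0 : (p : Piece n) → ∀ {x} → Member p x → 0 < weight p
Member⇒weight>0 p m = ≤-<-trans z≤n (near-centre p m)

Concentric⇒WithinStar : ∀ {c} {ps : List (Piece n)} → Concentric c ps → WithinStar c (Blocked ps)
Concentric⇒WithinStar {ps = p ∷ _} (on ∷ _) (here m) with on (Member⇒weight>0 p m)
... | refl = <-≤-trans (near-centre p m) (weight≤2 p) , λ adj → here (centre-member p m adj)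
Concentric⇒WithinStar (_ ∷ con) (there b) = map₂ (there ∘_) (Concentric⇒WithinStar con b)

concentric-or-stray : (c : Vertex n) (ps : List (Piece n)) →
                      Concentric c ps ⊎ Any (λ p → 0 < weight p × centre p ≢ c) ps
concentric-or-stray c [] = inj₁ []
concentric-or-stray c (p ∷ ps) with 0 <? weight p | ≡-dec _≟_ (centre p) c | concentric-or-stray c ps
... | yes positive | no off | _          = inj₂ (here (positive , off))
... | _            | _      | inj₂ stray = inj₂ (there stray)
... | yes _        | yes on | inj₁ con   = inj₁ ((λ _ → on) ∷ con)
... | no ¬positive | _      | inj₁ con   = inj₁ ((λ positive → contradiction positive ¬positive) ∷ con)

concentric-or-straddled : (ps : List (Piece n)) → (∃ λ c → Concentric c ps) ⊎ (∃ λ i → Straddles i ps)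
concentric-or-straddled [] = inj₁ (replicate _ false , [])
concentric-or-straddled (p ∷ ps) with 0 <? weight p
... | no ¬positive with concentric-or-straddled ps
...   | inj₁ (c , con) = inj₁ (c , (λ positive → contradiction positive ¬positive) ∷ con)
...   | inj₂ (i , str) = inj₂ (i , there ∘ str)
concentric-or-straddled (p ∷ ps) | yes positive with concentric-or-stray (centre p) ps
... | inj₁ con = inj₁ (centre p , (λ _ → refl) ∷ con)
... | inj₂ stray with find stray
...   | q , q∈ps , q-positive , q≢p with ≢⇒lookup≢ q≢p
...     | i , differ = inj₂ (i , straddle)
  where
  straddle : Straddles i (p ∷ ps)
  straddle b with lookup (centre p) i ≟ b
  ... | yes refl = there (lose q∈ps (q-positive , differ))
  ... | no p≢b   = here (positive , p≢b)

connected-if-cheap : ∀ n (ps : List (Piece n)) → cost ps < n → Connected (Blocked ps)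
connected-if-cheap zero    ps ()
connected-if-cheap (suc n) ps cheap with concentric-or-straddled ps
... | inj₁ (c , con)       = within-star-connected c (Concentric⇒WithinStar con)
... | inj₂ (i , straddles) =
  connected-from-slices i w slice-connected (λ b → bridge i b ps w (Allₚ.map⁻ far))
  where
  points : List (ℕ × Vertex n)
  points = map (λ p → weight p , removeAt (centre p) i) ps

  w-far : ∃ λ w → All (Far w) points
  w-far = far-vertex points (subst (_≤ n) (cong sum (map-∘ ps)) (s≤s⁻¹ cheap))

  w = proj₁ w-far
  far = proj₂ w-far

  slice-connected : ∀ b → Connected (λ x → Blocked ps (insertAt x i b))
  slice-connected b =
    Connected-resp-≐ (Blocked-slice i b ps)
      (connected-if-cheap n (map (slice i b) ps) (<-≤-trans (cost-slice-< i b ps (straddles b)) (s≤s⁻¹ cheap)))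

star : StarSub n → Piece n
star S = record
  { centre        = center S
  ; weight        = 2
  ; Member        = λ x → x ≡ center S ⊎ x ∈ leaves S
  ; weight≤2      = ≤-refl
  ; near-centre   = near
  ; centre-member = λ _ _ → inj₁ refl
  }
  where
  near : ∀ {x} → x ≡ center S ⊎ x ∈ leaves S → hamming (center S) x < 2
  near (inj₁ refl)     = subst (_< 2) (sym (hamming-self (center S))) z<s
  near (inj₂ x∈leaves) = subst (_< 2) (sym (All.lookup (adjacent S) x∈leaves)) (n<1+n 1)

cost-stars : (F : List (StarSub n)) → cost (map star F) ≡ length F * 2
cost-stars []      = refl
cost-stars (_ ∷ F) = cong (2 +_) (cost-stars F)

Blocked-stars : (F : List (StarSub n)) → Blocked (map star F) ≐ Removed F
Blocked-stars F = Any.map⁻ , Any.map⁺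

path⇒Reach : (F : List (StarSub n)) → ∀ {u v} → Star (Edge (Removed F)) u v → Reach F u v
path⇒Reach F ε                      = here
path⇒Reach F ((adj , _ , ¬Rw) ◅ p) = step adj ¬Rw (path⇒Reach F p)

few-stars-connected : (F : List (StarSub n)) → length F * 2 < n →
                      ∀ {u v} → ¬ Removed F u → ¬ Removed F v → Reach F u v
few-stars-connected {n} F cheap ¬Ru ¬Rv =
  path⇒Reach F
    (Connected-resp-≐ (Blocked-stars F)
       (connected-if-cheap n (map star F) (subst (_< n) (sym (cost-stars F)) cheap)) ¬Ru ¬Rv)

lemma4p7 : (F : List (StarSub 7)) → Disconnected F → 4 ≤ length F
lemma4p7 F (u , v , ¬Ru , ¬Rv , ¬reach) with 4 ≤? length F
... | yes four≤ = four≤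
... | no  four≰ = contradiction (few-stars-connected F three-stars ¬Ru ¬Rv) ¬reach
  where
  three-stars : length F * 2 < 7
  three-stars = s≤s (*-monoˡ-≤ 2 (s≤s⁻¹ (≰⇒> four≰)))
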